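{- There exists an absolute constant $c>0$ such that for every integer $t\geq 2$ and every $A\subseteq[t]^2$ with $|A|>t$, we have $\Delta(A)\geq c\,(|A|/t)^2$.
   Context: $[t]=\{0,\dots,t-1\}$, and $[t]^2$ carries the coordinate-wise order. For $A\subseteq[t]^n$, $\Delta(A)$ denotes the maximum degree of the comparability graph induced on $A$, i.e. the maximum over $x\in A$ of the number of $y\in A\setminus\{x\}$ comparable to $x$. -}

module Defs where

open import Data.Nat using (ℕ; _⊔_)
open import Data.Bool using (Bool; true; false; _∧_; not)
open import Data.Fin using (Fin)
open import Data.Fin.Properties using (_≤?_; _≟_)
open import Data.List using (List; length; filter; map; foldr; cartesianProduct; allFin)
open import Data.Product using (_×_; _,_)
open import Relation.Nullary using (Dec; yes; no; does)
open import Data.Sum using (_⊎_)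

Point : ℕ → Set
Point t = Fin t × Fin t

grid : (t : ℕ) → List (Point t)
grid t = cartesianProduct (allFin t) (allFin t)

GridSubset : ℕ → Set
GridSubset t = Point t → Bool

card : ∀ {t} → GridSubset t → ℕ
card {t} A = length (filter (λ p → A p Data.Bool.≟ true) (grid t))

leq : ∀ {t} → Point t → Point t → Bool
leq (a , b) (c , d) = does (a ≤? c) ∧ does (b ≤? d)

eqP : ∀ {t} → Point t → Point t → Bool
eqP (a , b) (c , d) = does (a ≟ c) ∧ does (b ≟ d)

comparable : ∀ {t} → Point t → Point t → Bool
comparable x y = leq x y Data.Bool.∨ leq y x

deg : ∀ {t} → GridSubset t → Point t → ℕ
deg {t} A x =
  length (filter (λ y → (A y ∧ not (eqP x y) ∧ comparable x y) Data.Bool.≟ true) (grid t))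

-- Δ(A): maximum degree of the comparability graph induced on A (0 if A = ∅)
Δ : ∀ {t} → GridSubset t → ℕ
Δ {t} A = foldr _⊔_ 0 (map (deg A) (filter (λ p → A p Data.Bool.≟ true) (grid t)))

module Submission where

-- Suppose [t]² is split into N classes such that two points of one class are comparable
-- unless they are "near", and every point has at most E near points.  All points of A in a
-- class are near to or comparable with any one of them, so |A| ≤ N (Δ(A) + E).  Columns
-- (N = t, E = 1) give |A| ≤ t (Δ + 1), hence Δ ≥ 1 since |A| > t.  Cutting [t]² into w × w
-- cells, the 2⌊t/w⌋ + 1 diagonals of cells give |A| ≤ (2t/w + 1)(Δ + w²).  For Δ < t² take
-- w = ⌊√Δ⌋ ≤ t: then |A| w ≤ 6 t Δ and Δ < 4 w², so |A|² ≤ 144 Δ t².  For Δ ≥ t² use |A| ≤ t².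

open import Defs

open import Data.Bool using (Bool; true; false; T; T?; not; _∧_; _∨_)
import Data.Bool as Bool
open import Data.Bool.Properties using (T-∧; T-∨; T-≡; ∧-zeroʳ; ∨-zeroʳ)
open import Data.Empty using (⊥-elim)
open import Data.Fin using (Fin; toℕ)
import Data.Fin.Properties as Fin
open import Data.List
  using (List; []; _∷_; _++_; length; filter; map; foldr; cartesianProduct; tabulate; allFin; applyUpTo; upTo)
open import Data.List.Properties using (filter-++; length-++; foldr-preservesᵒ; map-tabulate; upTo-∷ʳ)
open import Data.List.Membership.Propositional using (_∈_)
open import Data.List.Membership.Propositional.Properties
  using (∈-map⁺; ∈-filter⁺; ∈-cartesianProduct⁺; ∈-allFin)
import Data.List.Relation.Unary.Any as Any
open import Data.Nat
open import Data.Nat.DivMod using (_/_; _%_; m/n*n≤m; m≡m%n+[m/n]*n; m%n<n; /-monoˡ-≤)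
open import Data.Nat.Properties
open import Data.Nat.Tactic.RingSolver using (solve-∀)
open import Data.Product using (Σ; _×_; _,_; proj₁; proj₂; ∃; ∃-syntax)
open import Data.Sum using (_⊎_; inj₁; inj₂; [_,_])
open import Data.Unit using (tt)
open import Function using (_∘_; Equivalence)
open import Relation.Binary.Definitions using (tri<; tri≈; tri>)
open import Relation.Binary.PropositionalEquality using (_≡_; refl; sym; trans; cong; cong₂; module ≡-Reasoning)
open import Relation.Nullary using (¬_; does; yes; no; contradiction)
open import Relation.Nullary.Decidable using (dec-true; dec-false)

open Equivalence using (to; from)

private
  variable
    X Y : Set

-- Written with filter so that card A and deg A x are literally instances of count.
count : (X → Bool) → List X → ℕ
count P xs = length (filter (λ x → P x Bool.≟ true) xs)

count-++ : ∀ (P : X → Bool) xs ys → count P (xs ++ ys) ≡ count P xs + count P ys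
count-++ P xs ys = trans (cong length (filter-++ _ xs ys)) (length-++ (filter _ xs))

count-map : ∀ (P : Y → Bool) (f : X → Y) xs → count P (map f xs) ≡ count (P ∘ f) xs
count-map P f [] = refl
count-map P f (x ∷ xs) with P (f x)
... | true  = cong suc (count-map P f xs)
... | false = count-map P f xs

count-false : ∀ (xs : List X) → count (λ _ → false) xs ≡ 0
count-false []       = refl
count-false (x ∷ xs) = count-false xs

count-mono : ∀ {P Q : X → Bool} → (∀ x → T (P x) → T (Q x)) → ∀ xs → count P xs ≤ count Q xs
count-mono P⇒Q []       = z≤n
count-mono {P = P} {Q = Q} P⇒Q (x ∷ xs) with P x | Q x | P⇒Q x
... | true  | true  | _   = s≤s (count-mono P⇒Q xs)
... | true  | false | P⇒Q = ⊥-elim (P⇒Q tt)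
... | false | true  | _   = m≤n⇒m≤1+n (count-mono P⇒Q xs)
... | false | false | _   = count-mono P⇒Q xs

count-∨ : ∀ (P Q : X → Bool) xs → count (λ x → P x ∨ Q x) xs ≤ count P xs + count Q xs
count-∨ P Q []       = z≤n
count-∨ P Q (x ∷ xs) with P x | Q x
... | true  | true  = s≤s (≤-trans (count-∨ P Q xs) (+-monoʳ-≤ (count P xs) (n≤1+n _)))
... | true  | false = s≤s (count-∨ P Q xs)
... | false | true  = ≤-trans (s≤s (count-∨ P Q xs)) (≤-reflexive (sym (+-suc (count P xs) _)))
... | false | false = count-∨ P Q xs

count-∃ : ∀ (P : X → Bool) xs → count P xs ≡ 0 ⊎ ∃ (T ∘ P)
count-∃ P []       = inj₁ refl
count-∃ P (x ∷ xs) with P x in Px≡true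
... | true  = inj₂ (x , from T-≡ Px≡true)
... | false = count-∃ P xs

count-cartesianProduct : ∀ (P : X → Bool) (Q : Y → Bool) xs ys →
  count (λ (x , y) → P x ∧ Q y) (cartesianProduct xs ys) ≡ count P xs * count Q ys
count-cartesianProduct P Q []       ys = refl
count-cartesianProduct {X = X} {Y = Y} P Q (x ∷ xs) ys = begin
  count R (map (x ,_) ys ++ cartesianProduct xs ys)
    ≡⟨ count-++ R (map (x ,_) ys) _ ⟩
  count R (map (x ,_) ys) + count R (cartesianProduct xs ys)
    ≡⟨ cong₂ _+_ (count-map R (x ,_) ys) (count-cartesianProduct P Q xs ys) ⟩
  count (λ y → P x ∧ Q y) ys + count P xs * count Q ys
    ≡⟨ first-row ⟩
  count P (x ∷ xs) * count Q ys ∎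
  where
  open ≡-Reasoning
  R : X × Y → Bool
  R (x , y) = P x ∧ Q y
  first-row : count (λ y → P x ∧ Q y) ys + count P xs * count Q ys ≡ count P (x ∷ xs) * count Q ys
  first-row with P x
  ... | true  = refl
  ... | false = cong (_+ count P xs * count Q ys) (count-false ys)

count-fibres≤ : ∀ (P : X → Bool) (L : X → ℕ) {N c} xs → (∀ x → T (P x) → L x < N) →
                (∀ k → count (λ x → P x ∧ (L x ≡ᵇ k)) xs ≤ c) → count P xs ≤ N * c
count-fibres≤ P L {N} {c} xs L<N fibre≤c = ≤-trans
  (count-mono (λ x Px → from (T-∧ {P x}) (Px , <⇒<ᵇ (L<N x Px))) xs) (below N)
  where
  below : ∀ n → count (λ x → P x ∧ (L x <ᵇ n)) xs ≤ n * c
  below zero    = ≤-trans (count-mono (λ x h → n≮0 (<ᵇ⇒< (L x) 0 (proj₂ (to (T-∧ {P x}) h)))) xs)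
                          (≤-reflexive (count-false xs))
  below (suc n) = begin
    count (λ x → P x ∧ (L x <ᵇ suc n)) xs
      ≤⟨ count-mono split xs ⟩
    count (λ x → (P x ∧ (L x ≡ᵇ n)) ∨ (P x ∧ (L x <ᵇ n))) xs
      ≤⟨ count-∨ _ _ xs ⟩
    count (λ x → P x ∧ (L x ≡ᵇ n)) xs + count (λ x → P x ∧ (L x <ᵇ n)) xs
      ≤⟨ +-mono-≤ (fibre≤c n) (below n) ⟩
    suc n * c ∎
    where
    open ≤-Reasoning
    split : ∀ x → T (P x ∧ (L x <ᵇ suc n)) → T ((P x ∧ (L x ≡ᵇ n)) ∨ (P x ∧ (L x <ᵇ n)))
    split x h with to (T-∧ {P x}) h
    ... | Px , Lx<1+n with m<1+n⇒m<n∨m≡n (<ᵇ⇒< (L x) (suc n) Lx<1+n)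
    ... | inj₁ Lx<n = from (T-∨ {P x ∧ (L x ≡ᵇ n)}) (inj₂ (from (T-∧ {P x}) (Px , <⇒<ᵇ Lx<n)))
    ... | inj₂ Lx≡n = from (T-∨ {P x ∧ (L x ≡ᵇ n)}) (inj₁ (from (T-∧ {P x}) (Px , ≡⇒≡ᵇ (L x) n Lx≡n)))

≤-foldr-⊔ : ∀ {n ns} → n ∈ ns → n ≤ foldr _⊔_ 0 ns
≤-foldr-⊔ n∈ns =
  foldr-preservesᵒ (λ x y → [ m≤n⇒m≤n⊔o y , m≤n⇒m≤o⊔n x ]) 0 _ (inj₂ (Any.map ≤-reflexive n∈ns))

∈-grid : ∀ {t} (x : Point t) → x ∈ grid t
∈-grid (a , b) = ∈-cartesianProduct⁺ (∈-allFin a) (∈-allFin b)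

adjacent : ∀ {t} → Point t → Point t → Bool
adjacent x y = not (eqP x y) ∧ comparable x y

deg≤Δ : ∀ {t} (A : GridSubset t) x → T (A x) → deg A x ≤ Δ A
deg≤Δ A x Ax = ≤-foldr-⊔ (∈-map⁺ (deg A) (∈-filter⁺ (λ p → A p Bool.≟ true) (∈-grid x) (to T-≡ Ax)))

adjacent-< : ∀ {t} {a b c d : Fin t} → toℕ a ≤ toℕ c → toℕ b < toℕ d → T (adjacent (a , b) (c , d))
adjacent-< {a = a} {b} {c} {d} a≤c b<d
  rewrite dec-false (b Fin.≟ d) (<⇒≢ b<d ∘ cong toℕ) | ∧-zeroʳ (does (a Fin.≟ c))
        | dec-true (a Fin.≤? c) a≤c | dec-true (b Fin.≤? d) (<⇒≤ b<d) = tt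

adjacent-> : ∀ {t} {a b c d : Fin t} → toℕ c ≤ toℕ a → toℕ d < toℕ b → T (adjacent (a , b) (c , d))
adjacent-> {a = a} {b} {c} {d} c≤a d<b
  rewrite dec-false (b Fin.≟ d) (>⇒≢ d<b ∘ cong toℕ) | ∧-zeroʳ (does (a Fin.≟ c))
        | dec-true (c Fin.≤? a) c≤a | dec-true (d Fin.≤? b) (<⇒≤ d<b) | ∨-zeroʳ (leq (a , b) (c , d)) = tt

record ChainPartition (t : ℕ) : Set where
  field
    classes            : ℕ
    class              : Point t → ℕ
    class<classes      : ∀ x → class x < classes
    near               : Point t → Point t → Bool
    maxNear            : ℕ
    count-near≤maxNear : ∀ x → count (near x) (grid t) ≤ maxNear
    sameClass⇒adjacent : ∀ x y → class x ≡ class y → ¬ T (near x y) → T (adjacent x y)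

card≤classes*[Δ+maxNear] : ∀ {t} (C : ChainPartition t) (A : GridSubset t) →
  let open ChainPartition C in card A ≤ classes * (Δ A + maxNear)
card≤classes*[Δ+maxNear] {t} C A = count-fibres≤ A class (grid t) (λ x _ → class<classes x) fibre≤
  where
  open ChainPartition C
  inClass : ℕ → Point t → Bool
  inClass k x = A x ∧ (class x ≡ᵇ k)

  fibre≤ : ∀ k → count (inClass k) (grid t) ≤ Δ A + maxNear
  fibre≤ k with count-∃ (inClass k) (grid t)
  ... | inj₁ empty     = ≤-trans (≤-reflexive empty) z≤n
  ... | inj₂ (x , x∈k) = begin
    count (inClass k) (grid t)
      ≤⟨ count-mono covered (grid t) ⟩
    count (λ y → (A y ∧ adjacent x y) ∨ near x y) (grid t)
      ≤⟨ count-∨ _ (near x) (grid t) ⟩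
    deg A x + count (near x) (grid t)
      ≤⟨ +-mono-≤ (deg≤Δ A x Ax) (count-near≤maxNear x) ⟩
    Δ A + maxNear ∎
    where
    open ≤-Reasoning
    Ax : T (A x)
    Ax = proj₁ (to (T-∧ {A x}) x∈k)
    class-x≡k : class x ≡ k
    class-x≡k = ≡ᵇ⇒≡ (class x) k (proj₂ (to (T-∧ {A x}) x∈k))
    covered : ∀ y → T (inClass k y) → T ((A y ∧ adjacent x y) ∨ near x y)
    covered y y∈k with to (T-∧ {A y}) y∈k | T? (near x y)
    ... | _  , _       | yes x~y = from (T-∨ {A y ∧ adjacent x y}) (inj₂ x~y)
    ... | Ay , class-y | no ¬x~y = from (T-∨ {A y ∧ adjacent x y}) (inj₁ (from (T-∧ {A y}) (Ay ,
          sameClass⇒adjacent x y (trans class-x≡k (sym (≡ᵇ⇒≡ (class y) k class-y))) ¬x~y)))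

SupportedIn : (ℕ → Bool) → ℕ → ℕ → Set
SupportedIn Q lo w = ∀ v → T (Q v) → lo ≤ v × v < lo + w

count-upTo-≤ : ∀ (Q : ℕ → Bool) {lo w} n → SupportedIn Q lo w → count Q (upTo n) ≤ w
count-upTo-≤ Q {lo} {w} n supp = begin
  count Q (upTo n)        ≤⟨ below n ⟩
  n ⊓ (lo + w) ∸ lo       ≤⟨ ∸-monoˡ-≤ lo (m⊓n≤n n (lo + w)) ⟩
  lo + w ∸ lo             ≡⟨ m+n∸m≡n lo w ⟩
  w                       ∎
  where
  open ≤-Reasoning
  below : ∀ n → count Q (upTo n) ≤ n ⊓ (lo + w) ∸ lo
  below zero    = z≤n
  below (suc n) = begin
    count Q (upTo (suc n))              ≡⟨ cong (count Q) (sym (upTo-∷ʳ n)) ⟩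
    count Q (upTo n ++ n ∷ [])          ≡⟨ count-++ Q (upTo n) (n ∷ []) ⟩
    count Q (upTo n) + count Q (n ∷ []) ≤⟨ last ⟩
    suc n ⊓ (lo + w) ∸ lo               ∎
    where
    last : count Q (upTo n) + count Q (n ∷ []) ≤ suc n ⊓ (lo + w) ∸ lo
    last with Q n in Qn≡true
    ... | true  = begin
      count Q (upTo n) + 1      ≡⟨ +-comm _ 1 ⟩
      suc (count Q (upTo n))    ≤⟨ s≤s (below n) ⟩
      suc (n ⊓ (lo + w) ∸ lo)   ≡⟨ cong (λ m → suc (m ∸ lo)) (m≤n⇒m⊓n≡m (<⇒≤ n<lo+w)) ⟩
      suc (n ∸ lo)              ≡⟨ sym (+-∸-assoc 1 lo≤n) ⟩
      suc n ∸ lo                ≡⟨ cong (_∸ lo) (sym (m≤n⇒m⊓n≡m n<lo+w)) ⟩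
      suc n ⊓ (lo + w) ∸ lo     ∎
      where
      lo≤n : lo ≤ n
      lo≤n = proj₁ (supp n (from T-≡ Qn≡true))
      n<lo+w : n < lo + w
      n<lo+w = proj₂ (supp n (from T-≡ Qn≡true))
    ... | false = begin
      count Q (upTo n) + 0      ≡⟨ +-identityʳ _ ⟩
      count Q (upTo n)          ≤⟨ below n ⟩
      n ⊓ (lo + w) ∸ lo         ≤⟨ ∸-monoˡ-≤ lo (⊓-monoˡ-≤ (lo + w) (n≤1+n n)) ⟩
      suc n ⊓ (lo + w) ∸ lo     ∎

tabulate-∘toℕ : ∀ n (f : ℕ → X) → tabulate {n = n} (f ∘ toℕ) ≡ applyUpTo f n
tabulate-∘toℕ zero    f = refl
tabulate-∘toℕ (suc n) f = cong (f 0 ∷_) (tabulate-∘toℕ n (f ∘ suc))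

count-allFin-≤ : ∀ (Q : ℕ → Bool) {lo w} t → SupportedIn Q lo w → count (Q ∘ toℕ) (allFin t) ≤ w
count-allFin-≤ Q {w = w} t supp = begin
  count (Q ∘ toℕ) (allFin t)    ≡⟨ sym (count-map Q toℕ (allFin t)) ⟩
  count Q (map toℕ (allFin t))  ≡⟨ cong (count Q) map-toℕ-allFin ⟩
  count Q (upTo t)              ≤⟨ count-upTo-≤ Q t supp ⟩
  w                             ∎
  where
  open ≤-Reasoning
  map-toℕ-allFin : map toℕ (allFin t) ≡ upTo t
  map-toℕ-allFin = trans (map-tabulate (λ i → i) toℕ) (tabulate-∘toℕ t (λ i → i))

count-box : ∀ {t} (Q R : ℕ → Bool) {lo w lo′ w′} → SupportedIn Q lo w → SupportedIn R lo′ w′ →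
            count (λ (c , d) → Q (toℕ c) ∧ R (toℕ d)) (grid t) ≤ w * w′
count-box {t} Q R {w = w} {w′ = w′} suppQ suppR = begin
  count (λ (c , d) → Q (toℕ c) ∧ R (toℕ d)) (grid t)
    ≡⟨ count-cartesianProduct (Q ∘ toℕ) (R ∘ toℕ) (allFin t) (allFin t) ⟩
  count (Q ∘ toℕ) (allFin t) * count (R ∘ toℕ) (allFin t)
    ≤⟨ *-mono-≤ (count-allFin-≤ Q t suppQ) (count-allFin-≤ R t suppR) ⟩
  w * w′ ∎
  where open ≤-Reasoning

card≤t*t : ∀ {t} (A : GridSubset t) → card A ≤ t * t
card≤t*t {t} A = ≤-trans (count-mono inBox (grid t)) (count-box {t} (_<ᵇ t) (_<ᵇ t) below-t below-t)
  where
  inBox : ∀ ((c , d) : Point t) → T (A (c , d)) → T ((toℕ c <ᵇ t) ∧ (toℕ d <ᵇ t))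
  inBox (c , d) _ = from (T-∧ {toℕ c <ᵇ t}) (<⇒<ᵇ (Fin.toℕ<n c) , <⇒<ᵇ (Fin.toℕ<n d))
  below-t : SupportedIn (_<ᵇ t) 0 t
  below-t v v<t = z≤n , <ᵇ⇒< v t v<t

sameCell : ∀ {t} w .{{_ : NonZero w}} → Point t → Point t → Bool
sameCell w (a , b) (c , d) = (toℕ c / w ≡ᵇ toℕ a / w) ∧ (toℕ d / w ≡ᵇ toℕ b / w)

sameCell-intro : ∀ {t} w .{{_ : NonZero w}} {a b c d : Fin t} →
                 toℕ a / w ≡ toℕ c / w → toℕ b / w ≡ toℕ d / w → T (sameCell w (a , b) (c , d))
sameCell-intro w {a} {b} {c} {d} i≡i′ j≡j′ =
  from (T-∧ {toℕ c / w ≡ᵇ toℕ a / w}) (≡⇒≡ᵇ _ _ (sym i≡i′) , ≡⇒≡ᵇ _ _ (sym j≡j′))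

/-fibre : ∀ q w .{{_ : NonZero w}} → SupportedIn (λ v → v / w ≡ᵇ q) (q * w) w
/-fibre q w v v/w≡q with ≡ᵇ⇒≡ (v / w) q v/w≡q
... | refl = m/n*n≤m v w , (begin-strict
  v                   ≡⟨ m≡m%n+[m/n]*n v w ⟩
  v % w + v / w * w   <⟨ +-monoˡ-< (v / w * w) (m%n<n v w) ⟩
  w + v / w * w       ≡⟨ +-comm w _ ⟩
  v / w * w + w       ∎)
  where open ≤-Reasoning

count-sameCell≤ : ∀ {t} w .{{_ : NonZero w}} (x : Point t) → count (sameCell w x) (grid t) ≤ w * w
count-sameCell≤ {t} w (a , b) = count-box {t} _ _ (/-fibre (toℕ a / w) w) (/-fibre (toℕ b / w) w)

columns : ∀ t → ChainPartition t
columns t = record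
  { classes = t ; class = λ (a , _) → toℕ a ; class<classes = λ (a , _) → Fin.toℕ<n a
  ; near = sameCell 1 ; maxNear = 1 ; count-near≤maxNear = count-sameCell≤ 1
  ; sameClass⇒adjacent = sameColumn⇒adjacent }
  where
  sameColumn⇒adjacent : ∀ (x y : Point t) → toℕ (proj₁ x) ≡ toℕ (proj₁ y) →
                        ¬ T (sameCell 1 x y) → T (adjacent x y)
  sameColumn⇒adjacent (a , b) (c , d) a≡c ¬same with <-cmp (toℕ b) (toℕ d)
  ... | tri< b<d _ _ = adjacent-< (≤-reflexive a≡c) b<d
  ... | tri> _ _ d<b = adjacent-> (≤-reflexive (sym a≡c)) d<b
  ... | tri≈ _ b≡d _ =
    contradiction (sameCell-intro 1 {a} {b} {c} {d} (cong (_/ 1) a≡c) (cong (_/ 1) b≡d)) ¬same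

m/o<n/o⇒m<n : ∀ {m n} o .{{_ : NonZero o}} → m / o < n / o → m < n
m/o<n/o⇒m<n o m/o<n/o = ≰⇒> (λ n≤m → <⇒≱ m/o<n/o (/-monoˡ-≤ o n≤m))

equalDifference-< : ∀ {P i i′ j j′} → i + (P ∸ j) ≡ i′ + (P ∸ j′) → i < i′ → j < j′
equalDifference-< {P} eq i<i′ = ≰⇒> (λ j′≤j → <-irrefl eq (+-mono-<-≤ i<i′ (∸-monoʳ-≤ P j′≤j)))

equalDifference-≡ : ∀ {P i i′ j j′} → j ≤ P → j′ ≤ P → i + (P ∸ j) ≡ i′ + (P ∸ j′) → i ≡ i′ → j ≡ j′
equalDifference-≡ {i = i} j≤P j′≤P eq refl = ∸-cancelˡ-≡ j≤P j′≤P (+-cancelˡ-≡ i _ _ eq)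

diagonals : ∀ t w .{{_ : NonZero w}} → ChainPartition t
diagonals t w = record
  { classes = suc (t / w + t / w) ; class = diagonal ; class<classes = diagonal<
  ; near = sameCell w ; maxNear = w * w ; count-near≤maxNear = count-sameCell≤ w
  ; sameClass⇒adjacent = sameDiagonal⇒adjacent }
  where
  cell≤t/w : ∀ (a : Fin t) → toℕ a / w ≤ t / w
  cell≤t/w a = /-monoˡ-≤ w (Fin.toℕ≤n a)

  -- The cell index difference i − j, shifted by t / w to stay in ℕ.
  diagonal : Point t → ℕ
  diagonal (a , b) = toℕ a / w + (t / w ∸ toℕ b / w)

  diagonal< : ∀ x → diagonal x < suc (t / w + t / w)
  diagonal< (a , b) = s≤s (+-mono-≤ (cell≤t/w a) (m∸n≤m (t / w) (toℕ b / w)))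

  sameDiagonal⇒adjacent : ∀ x y → diagonal x ≡ diagonal y → ¬ T (sameCell w x y) → T (adjacent x y)
  sameDiagonal⇒adjacent (a , b) (c , d) eq ¬same with <-cmp (toℕ a / w) (toℕ c / w)
  ... | tri< i<i′ _ _ =
    adjacent-< (<⇒≤ (m/o<n/o⇒m<n w i<i′)) (m/o<n/o⇒m<n w (equalDifference-< eq i<i′))
  ... | tri> _ _ i′<i =
    adjacent-> (<⇒≤ (m/o<n/o⇒m<n w i′<i)) (m/o<n/o⇒m<n w (equalDifference-< (sym eq) i′<i))
  ... | tri≈ _ i≡i′ _ = contradiction
    (sameCell-intro w i≡i′ (equalDifference-≡ (cell≤t/w b) (cell≤t/w d) eq i≡i′)) ¬same

integer-sqrt : ∀ n → ∃[ w ] w * w ≤ n × n < suc w * suc w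
integer-sqrt zero    = 0 , z≤n , s≤s z≤n
integer-sqrt (suc n) with integer-sqrt n
... | w , w²≤n , n<[w+1]² with suc n <? suc w * suc w
...   | yes n+1<[w+1]² = w , m≤n⇒m≤1+n w²≤n , n+1<[w+1]²
...   | no  n+1≮[w+1]² =
  suc w , ≮⇒≥ n+1≮[w+1]² , ≤-<-trans n<[w+1]² (*-mono-< (n<1+n (suc w)) (n<1+n (suc w)))

n^2≡n*n : ∀ n → n ^ 2 ≡ n * n
n^2≡n*n n = cong (n *_) (*-identityʳ n)

square-bound-large : ∀ {m D t} → m ≤ t * t → t * t ≤ D → m ^ 2 ≤ 144 * D * t ^ 2
square-bound-large {m} {D} {t} m≤t² t²≤D = begin
  m ^ 2              ≡⟨ n^2≡n*n m ⟩
  m * m              ≤⟨ *-mono-≤ (≤-trans m≤t² t²≤D) m≤t² ⟩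
  D * (t * t)        ≤⟨ *-monoˡ-≤ (t * t) (m≤n*m D 144) ⟩
  144 * D * (t * t)  ≡⟨ cong (144 * D *_) (sym (n^2≡n*n t)) ⟩
  144 * D * t ^ 2    ∎
  where open ≤-Reasoning

square-bound-small : ∀ {m D t} w .{{_ : NonZero w}} → w ≤ t → w * w ≤ D → D < suc w * suc w →
  m ≤ suc (t / w + t / w) * (D + w * w) → m ^ 2 ≤ 144 * D * t ^ 2
square-bound-small {m} {D} {t} w w≤t w²≤D D<[w+1]² m≤cells =
  *-cancelʳ-≤ (m ^ 2) (144 * D * t ^ 2) (w * w) {{m*n≢0 w w}} (begin
    m ^ 2 * (w * w)                ≡⟨ cong (_* (w * w)) (n^2≡n*n m) ⟩
    m * m * (w * w)                ≡⟨ lhs m w ⟩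
    (m * w) * (m * w)              ≤⟨ *-mono-≤ mw≤6tD mw≤6tD ⟩
    6 * (t * D) * (6 * (t * D))    ≡⟨ mid t D ⟩
    36 * (t * t) * D * D           ≤⟨ *-monoʳ-≤ (36 * (t * t) * D) D≤4w² ⟩
    36 * (t * t) * D * (4 * (w * w)) ≡⟨ rhs t D w ⟩
    144 * D * (t * t) * (w * w)    ≡⟨ cong (λ s → 144 * D * s * (w * w)) (sym (n^2≡n*n t)) ⟩
    144 * D * t ^ 2 * (w * w)      ∎)
  where
  open ≤-Reasoning
  P : ℕ
  P = t / w
  lhs : ∀ m w → m * m * (w * w) ≡ (m * w) * (m * w)
  lhs = solve-∀
  mid : ∀ t D → 6 * (t * D) * (6 * (t * D)) ≡ 36 * (t * t) * D * D
  mid = solve-∀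
  rhs : ∀ t D w → 36 * (t * t) * D * (4 * (w * w)) ≡ 144 * D * (t * t) * (w * w)
  rhs = solve-∀
  D≤4w² : D ≤ 4 * (w * w)
  D≤4w² = begin
    D                    ≤⟨ <⇒≤ D<[w+1]² ⟩
    suc w * suc w        ≤⟨ *-mono-≤ w+1≤w+w w+1≤w+w ⟩
    (w + w) * (w + w)    ≡⟨ double² w ⟩
    4 * (w * w)          ∎
    where
    w+1≤w+w : suc w ≤ w + w
    w+1≤w+w = ≤-trans (≤-reflexive (+-comm 1 w)) (+-monoʳ-≤ w (>-nonZero⁻¹ w))
    double² : ∀ w → (w + w) * (w + w) ≡ 4 * (w * w)
    double² = solve-∀
  mw≤6tD : m * w ≤ 6 * (t * D)
  mw≤6tD = begin
    m * w                              ≤⟨ *-monoˡ-≤ w m≤cells ⟩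
    suc (P + P) * (D + w * w) * w      ≡⟨ regroup P w (D + w * w) ⟩
    (w + (P * w + P * w)) * (D + w * w)
      ≤⟨ *-mono-≤ (+-mono-≤ w≤t (+-mono-≤ Pw≤t Pw≤t)) (+-monoʳ-≤ D w²≤D) ⟩
    (t + (t + t)) * (D + D)            ≡⟨ sixfold t D ⟩
    6 * (t * D)                        ∎
    where
    Pw≤t : P * w ≤ t
    Pw≤t = m/n*n≤m t w
    regroup : ∀ P w E → suc (P + P) * E * w ≡ (w + (P * w + P * w)) * E
    regroup = solve-∀
    sixfold : ∀ t D → (t + (t + t)) * (D + D) ≡ 6 * (t * D)
    sixfold = solve-∀

square-bound : ∀ {m D t} → t < m → m ≤ t * (D + 1) → m ≤ t * t →
  (∀ w .{{_ : NonZero w}} → m ≤ suc (t / w + t / w) * (D + w * w)) → m ^ 2 ≤ 144 * D * t ^ 2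
square-bound {m} {zero} {t} t<m m≤t _ _ =
  contradiction (≤-trans m≤t (≤-reflexive (*-identityʳ t))) (<⇒≱ t<m)
square-bound {m} {D@(suc _)} {t} _ _ m≤t² m≤cells with t * t ≤? D | integer-sqrt D
... | yes t²≤D | _                           = square-bound-large {t = t} m≤t² t²≤D
... | no  _    | zero , _ , s≤s ()
... | no  t²≰D | w@(suc _) , w²≤D , D<[w+1]² = square-bound-small w w≤t w²≤D D<[w+1]² (m≤cells w)
  where
  w≤t : w ≤ t
  w≤t = ≮⇒≥ (λ t<w → t²≰D (≤-trans (*-mono-≤ (<⇒≤ t<w) (<⇒≤ t<w)) w²≤D))

lemma5p2 : Σ ℕ (λ K → (1 ≤ K) × ((t : ℕ) → 2 ≤ t → (A : GridSubset t) → t < card A →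
             card A ^ 2 ≤ K * Δ A * t ^ 2))
lemma5p2 = 144 , s≤s z≤n , λ t _ A t<|A| →
  square-bound t<|A| (card≤classes*[Δ+maxNear] (columns t) A) (card≤t*t A)
    (λ w → card≤classes*[Δ+maxNear] (diagonals t w) A)
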